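{- Every polynomial set with the integer atoms is equivariantly isomorphic to a finite disjoint union of monomial sets each of the form $\mathbb{Z}^k$ or $\mathbb{Z}_k$, for $k\in\mathbb{N}$.
   Context: Integer atoms: the atoms are $\mathbb{Z}$ with the successor function; the automorphisms are exactly the translations $x\mapsto x+z$, acting hereditarily on sets built from atoms (componentwise on tuples). A set or function is equivariant if invariant under all translations. For $k\ge1$, $\mathbb{Z}_k$ is the integers modulo $k$ with translations acting by addition, and $\mathbb{Z}_0=\mathbb{Z}$; $\mathbb{Z}^k$ is the $k$-fold product of $\mathbb{Z}$ with the diagonal action. Every equivariant single-orbit set is equivariantly isomorphic to some $\mathbb{Z}_k$. A monomial set is a finite Cartesian product of equivariant single-orbit sets; a polynomial set is a finite disjoint union of monomial sets. An equivariant isomorphism is a bijection commuting with all translations. -}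

module Defs where

open import Data.Nat using (ℕ; zero; suc)
open import Data.Integer using (ℤ; +_) renaming (_+_ to _+ℤ_)
open import Data.Integer.DivMod using (_%ℕ_; n%ℕd<d)
open import Data.Fin using (Fin; toℕ; fromℕ<)
open import Data.Unit using (⊤; tt)
open import Data.Empty using (⊥)
open import Data.Product using (Σ; _×_; _,_; proj₁; proj₂)
open import Data.Sum using (_⊎_; inj₁; inj₂)
open import Data.List using (List; []; _∷_; replicate)
open import Function.Definitions using (Bijective)
open import Relation.Binary.PropositionalEquality using (_≡_)

-- A set with an action of the translation group ℤ of the integer atoms.
record ZSet : Set₁ where
  field
    Carrier : Set
    act     : ℤ → Carrier → Carrier
open ZSet public

-- ℤ_k : integers modulo k (k ≥ 1) represented by Fin k; ℤ_0 = ℤ.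
ZmodCarrier : ℕ → Set
ZmodCarrier zero    = ℤ
ZmodCarrier (suc n) = Fin (suc n)

ZmodAct : (k : ℕ) → ℤ → ZmodCarrier k → ZmodCarrier k
ZmodAct zero    z x = z +ℤ x
ZmodAct (suc n) z i = fromℕ< (n%ℕd<d ((+ toℕ i) +ℤ z) (suc n))

Zmod : ℕ → ZSet
Zmod k = record { Carrier = ZmodCarrier k ; act = ZmodAct k }

OneZ : ZSet
OneZ = record { Carrier = ⊤ ; act = λ _ x → x }

EmptyZ : ZSet
EmptyZ = record { Carrier = ⊥ ; act = λ _ x → x }

_×Z_ : ZSet → ZSet → ZSet
A ×Z B = record { Carrier = Carrier A × Carrier B
                ; act = λ z p → act A z (proj₁ p) , act B z (proj₂ p) }

_⊎Z_ : ZSet → ZSet → ZSet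
A ⊎Z B = record { Carrier = Carrier A ⊎ Carrier B ; act = actS }
  where
  actS : ℤ → Carrier A ⊎ Carrier B → Carrier A ⊎ Carrier B
  actS z (inj₁ a) = inj₁ (act A z a)
  actS z (inj₂ b) = inj₂ (act B z b)

ProdZ : List ZSet → ZSet
ProdZ []       = OneZ
ProdZ (A ∷ As) = A ×Z ProdZ As

SumZ : List ZSet → ZSet
SumZ []       = EmptyZ
SumZ (A ∷ As) = A ⊎Z SumZ As

mapZ : {X : Set} → (X → ZSet) → List X → List ZSet
mapZ f []       = []
mapZ f (x ∷ xs) = f x ∷ mapZ f xs

-- A monomial set: finite product of single-orbit sets ℤ_{k₁} × … × ℤ_{kₙ}
-- (every equivariant single-orbit set is isomorphic to some ℤ_k).
Monomial : List ℕ → ZSet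
Monomial ks = ProdZ (mapZ Zmod ks)

Polynomial : List (List ℕ) → ZSet
Polynomial ms = SumZ (mapZ Monomial ms)

ZPow : ℕ → ZSet
ZPow k = ProdZ (replicate k (Zmod 0))

data Shape : Set where
  pow : ℕ → Shape
  cyc : ℕ → Shape

ShapeZ : Shape → ZSet
ShapeZ (pow k) = ZPow k
ShapeZ (cyc k) = Zmod k

NormalForm : List Shape → ZSet
NormalForm ss = SumZ (mapZ ShapeZ ss)

EquivIso : ZSet → ZSet → Set
EquivIso A B = Σ (Carrier A → Carrier B) λ f →
  Bijective _≡_ _≡_ f × (∀ (z : ℤ) (a : Carrier A) → f (act A z a) ≡ act B z (f a))

module Submission where

-- Polynomial sets, taken up to equivariant isomorphism, satisfy the semiring
-- laws for ⊎ and ×.  Hence it suffices to show that the product of one orbit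
-- ℤ_a with one normal-form shape (ℤ^m or ℤ_b) is isomorphic to a finite sum
-- of shapes; the theorem follows by induction over the factors of each
-- monomial and over the monomials of the polynomial.  The only non-formal
-- ingredient is the Chinese remainder isomorphism
--     ℤ_a × ℤ_b  ≅  gcd(a,b) copies of ℤ_lcm(a,b)        (gcd(a,b) ≠ 0),
-- whose case b = 0 reads ℤ_a × ℤ ≅ a copies of ℤ; the remaining products
-- ℤ × ℤ^m = ℤ^(m+1) and ℤ × ℤ = ℤ^2 hold by definition.

open import Defs
open import Data.Nat as ℕ using (ℕ; zero; suc; NonZero; ≢-nonZero)
import Data.Nat.Properties as ℕP
import Data.Nat.Divisibility as ℕ∣
open import Data.Nat.GCD using (gcd; gcd[m,n]∣m; gcd[m,n]∣n; gcd-GCD; gcd[m,n]≢0; gcd-identityʳ; module Bézout)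
open import Data.Nat.LCM using (lcm; m∣lcm[m,n]; n∣lcm[m,n]; lcm-least; lcm[n,0]≡0)
open import Data.Integer using (ℤ; +_; _-_; -_; ∣_∣) renaming (_+_ to _+ℤ_; _*_ to _*ℤ_)
import Data.Integer.Properties as ℤP
import Data.Integer.Divisibility.Signed as ℤ∣
open import Data.Integer.DivMod using (_%ℕ_; _/ℕ_; n%ℕd<d; a≡a%ℕn+[a/ℕn]*n)
open import Data.Integer.Tactic.RingSolver using (solve-∀)
open import Data.Fin as Fin using (Fin; toℕ; fromℕ<)
import Data.Fin.Properties as FinP
open import Data.Sum using (inj₁; inj₂)
open import Data.Product using (Σ; _×_; _,_; proj₁; proj₂)
open import Data.List using (List; []; _∷_; _++_; replicate)
open import Data.Unit using (tt)
open import Level using (0ℓ)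
open import Relation.Binary.Bundles using (Setoid)
import Relation.Binary.Reasoning.Setoid as SetoidReasoning
open import Relation.Binary.PropositionalEquality
open import Relation.Nullary using (contradiction)

-- Congruence modulo k on ℤ.  It is a record so that x and y can be
-- recovered from a proof by unification.
infix 4 _≡_mod_
record _≡_mod_ (x y : ℤ) (k : ℕ) : Set where
  constructor by-divisibility
  field divides-difference : + k ℤ∣.∣ (x - y)

private
  along : ∀ {k i j} → i ≡ j → + k ℤ∣.∣ i → + k ℤ∣.∣ j
  along {k} = subst (λ d → + k ℤ∣.∣ d)

mod-intro : ∀ {k x y} t → x - y ≡ t *ℤ + k → x ≡ y mod k
mod-intro t eq = by-divisibility (ℤ∣.divides t eq)

mod-refl : ∀ {k} x → x ≡ x mod k
mod-refl {k} x = mod-intro (+ 0) (trans (ℤP.+-inverseʳ x) (sym (ℤP.*-zeroˡ (+ k))))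

≡⇒mod : ∀ {k x y} → x ≡ y → x ≡ y mod k
≡⇒mod {x = x} refl = mod-refl x

mod-sym : ∀ {k x y} → x ≡ y mod k → y ≡ x mod k
mod-sym {x = x} {y} (by-divisibility k∣x-y) = by-divisibility (along (negate x y) (ℤ∣.∣m⇒∣-m k∣x-y))
  where negate : ∀ x y → - (x - y) ≡ y - x
        negate = solve-∀

mod-trans : ∀ {k x y z} → x ≡ y mod k → y ≡ z mod k → x ≡ z mod k
mod-trans {x = x} {y} {z} (by-divisibility h₁) (by-divisibility h₂) =
  by-divisibility (along (telescope x y z) (ℤ∣.∣m∣n⇒∣m+n h₁ h₂))
  where telescope : ∀ x y z → (x - y) +ℤ (y - z) ≡ x - z
        telescope = solve-∀

mod-+ : ∀ {k x x′ y y′} → x ≡ x′ mod k → y ≡ y′ mod k → x +ℤ y ≡ x′ +ℤ y′ mod k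
mod-+ {x = x} {x′} {y} {y′} (by-divisibility h₁) (by-divisibility h₂) =
  by-divisibility (along (regroup x x′ y y′) (ℤ∣.∣m∣n⇒∣m+n h₁ h₂))
  where regroup : ∀ x x′ y y′ → (x - x′) +ℤ (y - y′) ≡ (x +ℤ y) - (x′ +ℤ y′)
        regroup = solve-∀

mod-- : ∀ {k x x′ y y′} → x ≡ x′ mod k → y ≡ y′ mod k → x - y ≡ x′ - y′ mod k
mod-- {x = x} {x′} {y} {y′} (by-divisibility h₁) (by-divisibility h₂) =
  by-divisibility (along (regroup x x′ y y′) (ℤ∣.∣m∣n⇒∣m-n h₁ h₂))
  where regroup : ∀ x x′ y y′ → (x - x′) - (y - y′) ≡ (x - y) - (x′ - y′)
        regroup = solve-∀

mod-weaken : ∀ {k l x y} → k ℕ∣.∣ l → x ≡ y mod l → x ≡ y mod k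
mod-weaken {k} {l} k∣l (by-divisibility h) = by-divisibility (ℤ∣.∣-trans (ℤ∣.∣ᵤ⇒∣ {+ k} {+ l} k∣l) h)

mod-lcm : ∀ {a b x y} → x ≡ y mod a → x ≡ y mod b → x ≡ y mod lcm a b
mod-lcm {a} {b} {x} {y} (by-divisibility h₁) (by-divisibility h₂) =
  by-divisibility (ℤ∣.∣ᵤ⇒∣ {+ lcm a b} {x - y} (lcm-least (ℤ∣.∣⇒∣ᵤ h₁) (ℤ∣.∣⇒∣ᵤ h₂)))

mod-zero : ∀ {x y} → x ≡ y mod 0 → x ≡ y
mod-zero {x} {y} (by-divisibility (ℤ∣.divides t eq)) = ℤP.i-j≡0⇒i≡j x y (trans eq (ℤP.*-zeroʳ t))

mod-setoid : ℕ → Setoid 0ℓ 0ℓ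
mod-setoid k = record
  { Carrier = ℤ
  ; _≈_ = λ x y → x ≡ y mod k
  ; isEquivalence = record { refl = mod-refl _ ; sym = mod-sym ; trans = mod-trans }
  }

module ModReasoning (k : ℕ) = SetoidReasoning (mod-setoid k)

below-multiple : ∀ {d n} → d ℕ∣.∣ n → n ℕ.< d → n ≡ 0
below-multiple {n = zero}  _   _   = refl
below-multiple {n = suc _} d∣n n<d = contradiction d∣n (ℕ∣.>⇒∤ n<d)

residue-unique : ∀ {d r s} → r ℕ.< d → s ℕ.< d → + r ≡ + s mod d → r ≡ s
residue-unique {d} {r} {s} r<d s<d (by-divisibility d∣r-s) =
  ℤP.+-injective (ℤP.i-j≡0⇒i≡j (+ r) (+ s) (ℤP.∣i∣≡0⇒i≡0 distance-zero))
  where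
  distance-bound : ∣ + r - + s ∣ ℕ.≤ r ℕ.⊔ s
  distance-bound = subst (ℕ._≤ r ℕ.⊔ s) (cong ∣_∣ (sym (ℤP.m-n≡m⊖n r s))) (ℤP.∣m⊝n∣≤m⊔n r s)
  distance-zero : ∣ + r - + s ∣ ≡ 0
  distance-zero = below-multiple (ℤ∣.∣⇒∣ᵤ d∣r-s) (ℕP.≤-<-trans distance-bound (ℕP.⊔-lub r<d s<d))

%ℕ-congruent : ∀ x d .{{_ : NonZero d}} → + (x %ℕ d) ≡ x mod d
%ℕ-congruent x d = mod-sym (mod-intro (x /ℕ d) (begin
  x - r                          ≡⟨ cong (_- r) (a≡a%ℕn+[a/ℕn]*n x d) ⟩
  (r +ℤ (x /ℕ d) *ℤ + d) - r     ≡⟨ cancel r (x /ℕ d) (+ d) ⟩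
  (x /ℕ d) *ℤ + d                ∎))
  where
  open ≡-Reasoning
  r : ℤ
  r = + (x %ℕ d)
  cancel : ∀ r q d → (r +ℤ q *ℤ d) - r ≡ q *ℤ d
  cancel = solve-∀

%ℕ-unique : ∀ x d .{{_ : NonZero d}} {r} → r ℕ.< d → x ≡ + r mod d → x %ℕ d ≡ r
%ℕ-unique x d r<d x≡r = residue-unique (n%ℕd<d x d) r<d (mod-trans (%ℕ-congruent x d) x≡r)

reduce : (k : ℕ) → ℤ → ZmodCarrier k
reduce zero    x = x
reduce (suc n) x = fromℕ< (n%ℕd<d x (suc n))

lift : (k : ℕ) → ZmodCarrier k → ℤ
lift zero    x = x
lift (suc n) i = + toℕ i

act-lift : ∀ k z w → ZmodAct k z w ≡ reduce k (lift k w +ℤ z)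
act-lift zero    z w = ℤP.+-comm z w
act-lift (suc n) z w = refl

lift-reduce : ∀ k x → lift k (reduce k x) ≡ x mod k
lift-reduce zero    x = mod-refl x
lift-reduce (suc n) x = subst (λ r → + r ≡ x mod suc n) (sym (FinP.toℕ-fromℕ< (n%ℕd<d x (suc n))))
                              (%ℕ-congruent x (suc n))

reduce-lift : ∀ k w → reduce k (lift k w) ≡ w
reduce-lift zero    w = refl
reduce-lift (suc n) i = trans (FinP.fromℕ<-cong _ _ (%ℕ-unique (+ toℕ i) (suc n) i<k (mod-refl _)) _ i<k)
                              (FinP.fromℕ<-toℕ i i<k)
  where i<k : toℕ i ℕ.< suc n
        i<k = FinP.toℕ<n i

reduce-cong : ∀ k {x y} → x ≡ y mod k → reduce k x ≡ reduce k y
reduce-cong zero    x≡y = mod-zero x≡y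
reduce-cong (suc n) {x} {y} x≡y = FinP.fromℕ<-cong _ _
  (%ℕ-unique x (suc n) (n%ℕd<d y (suc n)) (mod-trans x≡y (mod-sym (%ℕ-congruent y (suc n))))) _ _

reduce-onto : ∀ k {x w} → x ≡ lift k w mod k → reduce k x ≡ w
reduce-onto k {w = w} x≡w = trans (reduce-cong k x≡w) (reduce-lift k w)

reduce-equivariant : ∀ k z x → reduce k (x +ℤ z) ≡ ZmodAct k z (reduce k x)
reduce-equivariant k z x =
  trans (reduce-cong k (mod-+ (mod-sym (lift-reduce k x)) (mod-refl z))) (sym (act-lift k z (reduce k x)))

lift-equivariant : ∀ k z w → lift k (ZmodAct k z w) ≡ lift k w +ℤ z mod k
lift-equivariant k z w = mod-trans (≡⇒mod (cong (lift k) (act-lift k z w))) (lift-reduce k _)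

infix 3 _≅_
record _≅_ (A B : ZSet) : Set where
  field
    to             : Carrier A → Carrier B
    from           : Carrier B → Carrier A
    from-to        : ∀ a → from (to a) ≡ a
    to-from        : ∀ b → to (from b) ≡ b
    to-equivariant : ∀ z a → to (act A z a) ≡ act B z (to a)
open _≅_

from-equivariant : ∀ {A B} (I : A ≅ B) z b → from I (act B z b) ≡ act A z (from I b)
from-equivariant {A} {B} I z b = begin
  from I (act B z b)                  ≡⟨ cong (λ b′ → from I (act B z b′)) (sym (to-from I b)) ⟩
  from I (act B z (to I (from I b)))  ≡⟨ cong (from I) (sym (to-equivariant I z (from I b))) ⟩
  from I (to I (act A z (from I b)))  ≡⟨ from-to I _ ⟩
  act A z (from I b)                  ∎
  where open ≡-Reasoning

≅⇒EquivIso : ∀ {A B} → A ≅ B → EquivIso A B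
≅⇒EquivIso I = to I , (injective , surjective) , to-equivariant I
  where
  injective : ∀ {a a′} → to I a ≡ to I a′ → a ≡ a′
  injective {a} {a′} eq = trans (sym (from-to I a)) (trans (cong (from I) eq) (from-to I a′))
  surjective : ∀ b → Σ _ λ a → ∀ {a′} → a′ ≡ a → to I a′ ≡ b
  surjective b = from I b , λ { refl → to-from I b }

≅-refl : ∀ {A} → A ≅ A
≅-refl = record { to = λ a → a ; from = λ a → a ; from-to = λ _ → refl ; to-from = λ _ → refl
                ; to-equivariant = λ _ _ → refl }

≅-sym : ∀ {A B} → A ≅ B → B ≅ A
≅-sym I = record { to = from I ; from = to I ; from-to = to-from I ; to-from = from-to I
                 ; to-equivariant = from-equivariant I }

infixr 4 _⨾_
_⨾_ : ∀ {A B C} → A ≅ B → B ≅ C → A ≅ C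
I ⨾ J = record
  { to             = λ a → to J (to I a)
  ; from           = λ c → from I (from J c)
  ; from-to        = λ a → trans (cong (from I) (from-to J (to I a))) (from-to I a)
  ; to-from        = λ c → trans (cong (to J) (to-from I (from J c))) (to-from J c)
  ; to-equivariant = λ z a → trans (cong (to J) (to-equivariant I z a)) (to-equivariant J z (to I a))
  }

⊎-cong : ∀ {A B C D} → A ≅ B → C ≅ D → (A ⊎Z C) ≅ (B ⊎Z D)
⊎-cong I J = record
  { to             = λ { (inj₁ a) → inj₁ (to I a) ; (inj₂ c) → inj₂ (to J c) }
  ; from           = λ { (inj₁ b) → inj₁ (from I b) ; (inj₂ d) → inj₂ (from J d) }
  ; from-to        = λ { (inj₁ a) → cong inj₁ (from-to I a) ; (inj₂ c) → cong inj₂ (from-to J c) }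
  ; to-from        = λ { (inj₁ b) → cong inj₁ (to-from I b) ; (inj₂ d) → cong inj₂ (to-from J d) }
  ; to-equivariant = λ { z (inj₁ a) → cong inj₁ (to-equivariant I z a)
                       ; z (inj₂ c) → cong inj₂ (to-equivariant J z c) }
  }

×-cong : ∀ {A B C D} → A ≅ B → C ≅ D → (A ×Z C) ≅ (B ×Z D)
×-cong I J = record
  { to             = λ (a , c) → to I a , to J c
  ; from           = λ (b , d) → from I b , from J d
  ; from-to        = λ (a , c) → cong₂ _,_ (from-to I a) (from-to J c)
  ; to-from        = λ (b , d) → cong₂ _,_ (to-from I b) (to-from J d)
  ; to-equivariant = λ z (a , c) → cong₂ _,_ (to-equivariant I z a) (to-equivariant J z c)
  }

⊎-identityˡ : ∀ {A} → (EmptyZ ⊎Z A) ≅ A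
⊎-identityˡ = record
  { to = λ { (inj₂ a) → a } ; from = inj₂ ; from-to = λ { (inj₂ a) → refl } ; to-from = λ _ → refl
  ; to-equivariant = λ { _ (inj₂ a) → refl } }

⊎-identityʳ : ∀ {A} → (A ⊎Z EmptyZ) ≅ A
⊎-identityʳ = record
  { to = λ { (inj₁ a) → a } ; from = inj₁ ; from-to = λ { (inj₁ a) → refl } ; to-from = λ _ → refl
  ; to-equivariant = λ { _ (inj₁ a) → refl } }

⊎-assoc : ∀ {A B C} → ((A ⊎Z B) ⊎Z C) ≅ (A ⊎Z (B ⊎Z C))
⊎-assoc = record
  { to      = λ { (inj₁ (inj₁ a)) → inj₁ a ; (inj₁ (inj₂ b)) → inj₂ (inj₁ b) ; (inj₂ c) → inj₂ (inj₂ c) }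
  ; from    = λ { (inj₁ a) → inj₁ (inj₁ a) ; (inj₂ (inj₁ b)) → inj₁ (inj₂ b) ; (inj₂ (inj₂ c)) → inj₂ c }
  ; from-to = λ { (inj₁ (inj₁ a)) → refl ; (inj₁ (inj₂ b)) → refl ; (inj₂ c) → refl }
  ; to-from = λ { (inj₁ a) → refl ; (inj₂ (inj₁ b)) → refl ; (inj₂ (inj₂ c)) → refl }
  ; to-equivariant = λ { _ (inj₁ (inj₁ a)) → refl ; _ (inj₁ (inj₂ b)) → refl ; _ (inj₂ c) → refl }
  }

×-identityʳ : ∀ {A} → (A ×Z OneZ) ≅ A
×-identityʳ = record { to = proj₁ ; from = λ a → a , tt ; from-to = λ _ → refl ; to-from = λ _ → refl
                     ; to-equivariant = λ _ _ → refl }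

×-zeroʳ : ∀ {A} → (A ×Z EmptyZ) ≅ EmptyZ
×-zeroʳ = record { to = proj₂ ; from = λ () ; from-to = λ { (_ , ()) } ; to-from = λ ()
                 ; to-equivariant = λ { _ (_ , ()) } }

×-assoc : ∀ {A B C} → (A ×Z (B ×Z C)) ≅ ((A ×Z B) ×Z C)
×-assoc = record
  { to = λ (a , (b , c)) → (a , b) , c ; from = λ ((a , b) , c) → a , (b , c)
  ; from-to = λ _ → refl ; to-from = λ _ → refl ; to-equivariant = λ _ _ → refl }

×-distribˡ-⊎ : ∀ {A B C} → (A ×Z (B ⊎Z C)) ≅ ((A ×Z B) ⊎Z (A ×Z C))
×-distribˡ-⊎ = record
  { to      = λ { (a , inj₁ b) → inj₁ (a , b) ; (a , inj₂ c) → inj₂ (a , c) }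
  ; from    = λ { (inj₁ (a , b)) → a , inj₁ b ; (inj₂ (a , c)) → a , inj₂ c }
  ; from-to = λ { (a , inj₁ b) → refl ; (a , inj₂ c) → refl }
  ; to-from = λ { (inj₁ (a , b)) → refl ; (inj₂ (a , c)) → refl }
  ; to-equivariant = λ { _ (a , inj₁ b) → refl ; _ (a , inj₂ c) → refl }
  }

NormalForm-++ : ∀ S₁ S₂ → (NormalForm S₁ ⊎Z NormalForm S₂) ≅ NormalForm (S₁ ++ S₂)
NormalForm-++ []       S₂ = ⊎-identityˡ
NormalForm-++ (s ∷ S₁) S₂ = ⊎-assoc ⨾ ⊎-cong ≅-refl (NormalForm-++ S₁ S₂)

single-shape : ∀ s → ShapeZ s ≅ NormalForm (s ∷ [])
single-shape s = ≅-sym ⊎-identityʳ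

Trivial : ℕ → ZSet
Trivial n = record { Carrier = Fin n ; act = λ _ i → i }

Trivial-suc : ∀ {n X} → (Trivial (suc n) ×Z X) ≅ (X ⊎Z (Trivial n ×Z X))
Trivial-suc = record
  { to      = λ { (Fin.zero , x) → inj₁ x ; (Fin.suc i , x) → inj₂ (i , x) }
  ; from    = λ { (inj₁ x) → Fin.zero , x ; (inj₂ (i , x)) → Fin.suc i , x }
  ; from-to = λ { (Fin.zero , x) → refl ; (Fin.suc i , x) → refl }
  ; to-from = λ { (inj₁ x) → refl ; (inj₂ (i , x)) → refl }
  ; to-equivariant = λ { _ (Fin.zero , x) → refl ; _ (Fin.suc i , x) → refl }
  }

copies : ∀ n s → (Trivial n ×Z ShapeZ s) ≅ NormalForm (replicate n s)
copies zero    s = record { to = λ { (() , _) } ; from = λ () ; from-to = λ { (() , _) } ; to-from = λ ()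
                          ; to-equivariant = λ { _ (() , _) } }
copies (suc n) s = Trivial-suc ⨾ ⊎-cong ≅-refl (copies n s)

ℕ-identity⇒ℤ : ∀ d p q r s → d ℕ.+ p ℕ.* q ≡ r ℕ.* s → + d ≡ + r *ℤ + s - + p *ℤ + q
ℕ-identity⇒ℤ d p q r s eq = begin
  + d                               ≡⟨ add-sub (+ d) (+ p *ℤ + q) ⟩
  (+ d +ℤ + p *ℤ + q) - + p *ℤ + q  ≡⟨ cong (_- + p *ℤ + q) lhs ⟩
  + r *ℤ + s - + p *ℤ + q           ∎
  where
  open ≡-Reasoning
  add-sub : ∀ d e → d ≡ (d +ℤ e) - e
  add-sub = solve-∀
  lhs : + d +ℤ + p *ℤ + q ≡ + r *ℤ + s
  lhs = begin
    + d +ℤ + p *ℤ + q     ≡⟨ cong (+ d +ℤ_) (sym (ℤP.pos-* p q)) ⟩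
    + d +ℤ + (p ℕ.* q)    ≡⟨ sym (ℤP.pos-+ d (p ℕ.* q)) ⟩
    + (d ℕ.+ p ℕ.* q)     ≡⟨ cong +_ eq ⟩
    + (r ℕ.* s)           ≡⟨ ℤP.pos-* r s ⟩
    + r *ℤ + s            ∎

bezout : ∀ a b → Σ ℤ λ u → Σ ℤ λ v → + gcd a b ≡ u *ℤ + a +ℤ v *ℤ + b
bezout a b with Bézout.identity (gcd-GCD a b)
... | Bézout.+- x y eq = + x , - + y , trans (ℕ-identity⇒ℤ (gcd a b) y b x a eq) (rearrange (+ x) (+ a) (+ y) (+ b))
  where rearrange : ∀ x a y b → x *ℤ a - y *ℤ b ≡ x *ℤ a +ℤ (- y) *ℤ b
        rearrange = solve-∀
... | Bézout.-+ x y eq = - + x , + y , trans (ℕ-identity⇒ℤ (gcd a b) x a y b eq) (rearrange (+ x) (+ a) (+ y) (+ b))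
  where rearrange : ∀ x a y b → y *ℤ b - x *ℤ a ≡ (- x) *ℤ a +ℤ y *ℤ b
        rearrange = solve-∀

-- Forwards, (c , w) with representative X ↦ (X , c + X); backwards,
-- (x , y) ↦ (the residue c of y - x modulo g , a common solution X of
-- X ≡ x (mod a) and X ≡ y - c (mod b), found with Bézout's identity).
module ChineseRemainder (a b : ℕ) .{{_ : NonZero (gcd a b)}} where

  g l : ℕ
  g = gcd a b
  l = lcm a b

  u v : ℤ
  u = proj₁ (bezout a b)
  v = proj₁ (proj₂ (bezout a b))

  g≡ua+vb : + g ≡ u *ℤ + a +ℤ v *ℤ + b
  g≡ua+vb = proj₂ (proj₂ (bezout a b))

  toPair : Fin g × ZmodCarrier l → ZmodCarrier a × ZmodCarrier b
  toPair (c , w) = reduce a (lift l w) , reduce b (+ toℕ c +ℤ lift l w)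

  offset : ℤ → ℤ → ℕ
  offset x y = (y - x) %ℕ g

  quotient : ℤ → ℤ → ℤ
  quotient x y = (y - x) /ℕ g

  solution : ℤ → ℤ → ℤ
  solution x y = x +ℤ quotient x y *ℤ u *ℤ + a

  solution-mod-a : ∀ x y → solution x y ≡ x mod a
  solution-mod-a x y = mod-intro (quotient x y *ℤ u) (cancel x (quotient x y) u (+ a))
    where cancel : ∀ x t u a → (x +ℤ t *ℤ u *ℤ a) - x ≡ (t *ℤ u) *ℤ a
          cancel = solve-∀

  -- Since y - x - c = t (u a + v b), the difference below is -(t v) b.
  solution-mod-b : ∀ x y → solution x y ≡ y - + offset x y mod b
  solution-mod-b x y = mod-intro (- (t *ℤ v)) (begin
    (x +ℤ t *ℤ u *ℤ + a) - (y - c)                            ≡⟨ regroup x y c t u (+ a) ⟩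
    (c - (y - x)) +ℤ t *ℤ u *ℤ + a                            ≡⟨ cong (λ e → (c - e) +ℤ t *ℤ u *ℤ + a) (a≡a%ℕn+[a/ℕn]*n (y - x) g) ⟩
    (c - (c +ℤ t *ℤ + g)) +ℤ t *ℤ u *ℤ + a                    ≡⟨ cong (λ e → (c - (c +ℤ t *ℤ e)) +ℤ t *ℤ u *ℤ + a) g≡ua+vb ⟩
    (c - (c +ℤ t *ℤ (u *ℤ + a +ℤ v *ℤ + b))) +ℤ t *ℤ u *ℤ + a ≡⟨ cancel c t u v (+ a) (+ b) ⟩
    - (t *ℤ v) *ℤ + b                                          ∎)
    where
    open ≡-Reasoning
    c t : ℤ
    c = + offset x y
    t = quotient x y
    regroup : ∀ x y c t u a → (x +ℤ t *ℤ u *ℤ a) - (y - c) ≡ (c - (y - x)) +ℤ t *ℤ u *ℤ a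
    regroup = solve-∀
    cancel : ∀ c t u v a b → (c - (c +ℤ t *ℤ (u *ℤ a +ℤ v *ℤ b))) +ℤ t *ℤ u *ℤ a ≡ - (t *ℤ v) *ℤ b
    cancel = solve-∀

  offsetFin : ℤ → ℤ → Fin g
  offsetFin x y = fromℕ< (n%ℕd<d (y - x) g)

  fromPair : ZmodCarrier a × ZmodCarrier b → Fin g × ZmodCarrier l
  fromPair (p , q) = offsetFin (lift a p) (lift b q) , reduce l (solution (lift a p) (lift b q))

  offset-unique : ∀ {x y X} (c : Fin g) → x ≡ X mod a → y ≡ + toℕ c +ℤ X mod b → offset x y ≡ toℕ c
  offset-unique {x} {y} {X} c x≡X y≡c+X = %ℕ-unique (y - x) g (FinP.toℕ<n c) (begin
    y - x               ≈⟨ mod-- (mod-weaken (gcd[m,n]∣n a b) y≡c+X) (mod-weaken (gcd[m,n]∣m a b) x≡X) ⟩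
    (+ toℕ c +ℤ X) - X  ≡⟨ cancel (+ toℕ c) X ⟩
    + toℕ c             ∎)
    where
    open ModReasoning g
    cancel : ∀ c X → (c +ℤ X) - X ≡ c
    cancel = solve-∀

  solution-unique : ∀ {x y X} (c : Fin g) → x ≡ X mod a → y ≡ + toℕ c +ℤ X mod b → solution x y ≡ X mod l
  solution-unique {x} {y} {X} c x≡X y≡c+X = mod-lcm (mod-trans (solution-mod-a x y) x≡X) (begin
    solution x y                 ≈⟨ solution-mod-b x y ⟩
    y - + offset x y             ≡⟨ cong (λ o → y - + o) (offset-unique c x≡X y≡c+X) ⟩
    y - + toℕ c                  ≈⟨ mod-- y≡c+X (mod-refl (+ toℕ c)) ⟩
    (+ toℕ c +ℤ X) - + toℕ c     ≡⟨ cancel (+ toℕ c) X ⟩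
    X                            ∎)
    where
    open ModReasoning b
    cancel : ∀ c X → (c +ℤ X) - c ≡ X
    cancel = solve-∀

  fromPair-toPair : ∀ cw → fromPair (toPair cw) ≡ cw
  fromPair-toPair (c , w) = cong₂ _,_
    (FinP.toℕ-injective (trans (FinP.toℕ-fromℕ< _) (offset-unique c x≡X y≡c+X)))
    (reduce-onto l (solution-unique c x≡X y≡c+X))
    where
    x≡X : lift a (reduce a (lift l w)) ≡ lift l w mod a
    x≡X = lift-reduce a (lift l w)
    y≡c+X : lift b (reduce b (+ toℕ c +ℤ lift l w)) ≡ + toℕ c +ℤ lift l w mod b
    y≡c+X = lift-reduce b (+ toℕ c +ℤ lift l w)

  toPair-fromPair : ∀ pq → toPair (fromPair pq) ≡ pq
  toPair-fromPair (p , q) = cong₂ _,_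
    (reduce-onto a (mod-trans (mod-weaken (m∣lcm[m,n] a b) X≡s) (solution-mod-a x y)))
    (reduce-onto b (begin
      + toℕ (offsetFin x y) +ℤ lift l (reduce l s)  ≈⟨ mod-+ (≡⇒mod (cong +_ (FinP.toℕ-fromℕ< _)))
                                                             (mod-weaken (n∣lcm[m,n] a b) X≡s) ⟩
      + offset x y +ℤ s                              ≈⟨ mod-+ (mod-refl (+ offset x y)) (solution-mod-b x y) ⟩
      + offset x y +ℤ (y - + offset x y)             ≡⟨ cancel (+ offset x y) y ⟩
      y                                              ∎))
    where
    open ModReasoning b
    x y s : ℤ
    x = lift a p
    y = lift b q
    s = solution x y
    X≡s : lift l (reduce l s) ≡ s mod l
    X≡s = lift-reduce l s
    cancel : ∀ c y → c +ℤ (y - c) ≡ y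
    cancel = solve-∀

  toPair-equivariant : ∀ z cw → toPair (act (Trivial g ×Z Zmod l) z cw) ≡ act (Zmod a ×Z Zmod b) z (toPair cw)
  toPair-equivariant z (c , w) = cong₂ _,_
    (trans (reduce-cong a (mod-weaken (m∣lcm[m,n] a b) X-shift)) (reduce-equivariant a z X))
    (trans (reduce-cong b (mod-trans (mod-+ (mod-refl (+ toℕ c)) (mod-weaken (n∣lcm[m,n] a b) X-shift))
                                     (≡⇒mod (sym (ℤP.+-assoc (+ toℕ c) X z)))))
           (reduce-equivariant b z (+ toℕ c +ℤ X)))
    where
    X : ℤ
    X = lift l w
    X-shift : lift l (ZmodAct l z w) ≡ X +ℤ z mod l
    X-shift = lift-equivariant l z w

  isomorphism : (Zmod a ×Z Zmod b) ≅ (Trivial g ×Z Zmod l)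
  isomorphism = ≅-sym (record
    { to = toPair ; from = fromPair ; from-to = fromPair-toPair ; to-from = toPair-fromPair
    ; to-equivariant = toPair-equivariant })

chinese-remainder : ∀ a b .{{_ : NonZero (gcd a b)}} → (Zmod a ×Z Zmod b) ≅ (Trivial (gcd a b) ×Z Zmod (lcm a b))
chinese-remainder a b = ChineseRemainder.isomorphism a b

gcd-nonZeroˡ : ∀ n b → NonZero (gcd (suc n) b)
gcd-nonZeroˡ n b = ≢-nonZero (gcd[m,n]≢0 (suc n) b (inj₁ λ ()))

gcd-nonZeroʳ : ∀ a n → NonZero (gcd a (suc n))
gcd-nonZeroʳ a n = ≢-nonZero (gcd[m,n]≢0 a (suc n) (inj₂ λ ()))

cyclic×ℤ : ∀ n → (Zmod (suc n) ×Z Zmod 0) ≅ (Trivial (suc n) ×Z Zmod 0)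
cyclic×ℤ n = subst₂ (λ g l → (Zmod (suc n) ×Z Zmod 0) ≅ (Trivial g ×Z Zmod l))
                    (gcd-identityʳ (suc n)) (lcm[n,0]≡0 (suc n))
                    (chinese-remainder (suc n) 0 {{gcd-nonZeroˡ n 0}})

HasNormalForm : ZSet → Set
HasNormalForm A = Σ (List Shape) λ S → A ≅ NormalForm S

≅-normal-form : ∀ {A B} → A ≅ B → HasNormalForm B → HasNormalForm A
≅-normal-form I (S , J) = S , I ⨾ J

⊎-normal-form : ∀ {A B} → HasNormalForm A → HasNormalForm B → HasNormalForm (A ⊎Z B)
⊎-normal-form (S₁ , I₁) (S₂ , I₂) = S₁ ++ S₂ , ⊎-cong I₁ I₂ ⨾ NormalForm-++ S₁ S₂

times-shape : ∀ a s → HasNormalForm (Zmod a ×Z ShapeZ s)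
times-shape zero    (pow m)       = pow (suc m) ∷ [] , single-shape (pow (suc m))
times-shape (suc n) (pow zero)    = cyc (suc n) ∷ [] , ×-identityʳ ⨾ single-shape (cyc (suc n))
times-shape (suc n) (pow (suc m)) = replicate (suc n) (pow (suc m)) ,
  ×-assoc ⨾ ×-cong (cyclic×ℤ n) ≅-refl ⨾ ≅-sym ×-assoc ⨾ copies (suc n) (pow (suc m))
times-shape zero    (cyc zero)    = pow 2 ∷ [] , ×-cong ≅-refl (≅-sym ×-identityʳ) ⨾ single-shape (pow 2)
times-shape zero    (cyc (suc m)) = replicate (gcd 0 (suc m)) (cyc (lcm 0 (suc m))) ,
  chinese-remainder 0 (suc m) {{gcd-nonZeroʳ 0 m}} ⨾ copies _ _
times-shape (suc n) (cyc b)       = replicate (gcd (suc n) b) (cyc (lcm (suc n) b)) ,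
  chinese-remainder (suc n) b {{gcd-nonZeroˡ n b}} ⨾ copies _ _

times-normal-form : ∀ a S → HasNormalForm (Zmod a ×Z NormalForm S)
times-normal-form a []      = [] , ×-zeroʳ
times-normal-form a (s ∷ S) = ≅-normal-form ×-distribˡ-⊎ (⊎-normal-form (times-shape a s) (times-normal-form a S))

monomial-normal-form : ∀ ks → HasNormalForm (Monomial ks)
monomial-normal-form []       = pow 0 ∷ [] , single-shape (pow 0)
monomial-normal-form (k ∷ ks) with monomial-normal-form ks
... | S , I = ≅-normal-form (×-cong ≅-refl I) (times-normal-form k S)

polynomial-normal-form : ∀ P → HasNormalForm (Polynomial P)
polynomial-normal-form []      = [] , ≅-refl
polynomial-normal-form (m ∷ P) = ⊎-normal-form (monomial-normal-form m) (polynomial-normal-form P)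

lemma2 : (P : List (List ℕ)) → Σ (List Shape) (λ S → EquivIso (Polynomial P) (NormalForm S))
lemma2 P with polynomial-normal-form P
... | S , I = S , ≅⇒EquivIso I
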